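{- Let $n$ be a positive integer. Then $r(T_{n-3}',T_n'')=r(T_{n-3}',T_n''')=2n-9$ for $n\ge 10$, and $r(T_{n-3}',T_n^3)=2n-9$ for $n\ge 15$.
   Context: All graphs are finite simple graphs. For graphs $G_1,G_2$, the Ramsey number $r(G_1,G_2)$ is the smallest positive integer $N$ such that for every graph $G$ on $N$ vertices, either $G$ contains a (not necessarily induced) subgraph isomorphic to $G_1$, or the complement $\overline{G}$ contains a subgraph isomorphic to $G_2$. $T_k'$ is the unique tree on $k$ vertices with maximum degree $k-2$. On vertex set $\{v_0,\ldots,v_{n-1}\}$: $T_n''$ has edges $v_0v_1,\ldots,v_0v_{n-4},v_1v_{n-3},v_1v_{n-2},v_2v_{n-1}$; $T_n'''$ has edges $v_0v_1,\ldots,v_0v_{n-4},v_1v_{n-3},v_2v_{n-2},v_3v_{n-1}$; $T_n^3$ has edges $v_0v_1,\ldots,v_0v_{n-4},v_{n-4}v_{n-3},v_{n-4}v_{n-2},v_{n-4}v_{n-1}$. -}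

module Defs where

open import Data.Nat using (ℕ; zero; suc; _∸_; _≤_; _<_)
open import Data.Fin using (Fin; toℕ; _≟_)
open import Data.Bool using (Bool; true; false; not)
open import Data.Product using (Σ; _×_; _,_)
open import Data.Sum using (_⊎_)
open import Relation.Nullary using (¬_; yes; no)
open import Relation.Binary.PropositionalEquality using (_≡_; refl; sym; cong)
open import Function.Definitions using (Injective)

record SimpleGraph (N : ℕ) : Set where
  field
    adj    : Fin N → Fin N → Bool
    adj-sym : ∀ i j → adj i j ≡ adj j i
    adj-irrefl : ∀ i → adj i i ≡ false
open SimpleGraph public

compAdj : ∀ {N} → SimpleGraph N → Fin N → Fin N → Bool
compAdj G i j with i ≟ j
... | yes _ = false
... | no _  = not (adj G i j)

compAdj-sym : ∀ {N} (G : SimpleGraph N) i j → compAdj G i j ≡ compAdj G j i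
compAdj-sym G i j with i ≟ j | j ≟ i
... | yes _ | yes _ = refl
... | yes p | no q = Data.Empty.⊥-elim (q (sym p)) where import Data.Empty
... | no q | yes p = Data.Empty.⊥-elim (q (sym p)) where import Data.Empty
... | no _ | no _ = cong not (adj-sym G i j)

compAdj-irrefl : ∀ {N} (G : SimpleGraph N) i → compAdj G i i ≡ false
compAdj-irrefl G i with i ≟ i
... | yes _ = refl
... | no q = Data.Empty.⊥-elim (q refl) where import Data.Empty

complement : ∀ {N} → SimpleGraph N → SimpleGraph N
complement G = record
  { adj = compAdj G ; adj-sym = compAdj-sym G ; adj-irrefl = compAdj-irrefl G }

-- A pattern graph on vertex set {v_0,...,v_{k-1}} (identified with Fin k),
-- given by its edge relation on indices: E a b means v_a v_b is an edge.
Contains : ∀ {N} → SimpleGraph N → (k : ℕ) → (ℕ → ℕ → Set) → Set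
Contains {N} G k E =
  Σ (Fin k → Fin N) λ f →
    Injective _≡_ _≡_ f × (∀ i j → E (toℕ i) (toℕ j) → adj G (f i) (f j) ≡ true)

Arrows : (N k₁ : ℕ) (E₁ : ℕ → ℕ → Set) (k₂ : ℕ) (E₂ : ℕ → ℕ → Set) → Set
Arrows N k₁ E₁ k₂ E₂ =
  (G : SimpleGraph N) → Contains G k₁ E₁ ⊎ Contains (complement G) k₂ E₂

IsRamseyNumber : (k₁ : ℕ) (E₁ : ℕ → ℕ → Set) (k₂ : ℕ) (E₂ : ℕ → ℕ → Set) → ℕ → Set
IsRamseyNumber k₁ E₁ k₂ E₂ m =
  1 ≤ m × Arrows m k₁ E₁ k₂ E₂ × (∀ N → 1 ≤ N → N < m → ¬ Arrows N k₁ E₁ k₂ E₂)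

starEdge : ℕ → ℕ → ℕ → Set
starEdge t a b = a ≡ 0 × (1 ≤ b × b ≤ t)

-- T'_k on {v_0..v_{k-1}}: edges v_0v_1,...,v_0v_{k-2}, v_1v_{k-1}
-- (the unique tree on k vertices with maximum degree k-2).
T′ : ℕ → ℕ → ℕ → Set
T′ k a b = starEdge (k ∸ 2) a b ⊎ (a ≡ 1 × b ≡ k ∸ 1)

T″ : ℕ → ℕ → ℕ → Set
T″ n a b = starEdge (n ∸ 4) a b ⊎ (a ≡ 1 × b ≡ n ∸ 3)
         ⊎ (a ≡ 1 × b ≡ n ∸ 2) ⊎ (a ≡ 2 × b ≡ n ∸ 1)

T‴ : ℕ → ℕ → ℕ → Set
T‴ n a b = starEdge (n ∸ 4) a b ⊎ (a ≡ 1 × b ≡ n ∸ 3)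
         ⊎ (a ≡ 2 × b ≡ n ∸ 2) ⊎ (a ≡ 3 × b ≡ n ∸ 1)

T³ : ℕ → ℕ → ℕ → Set
T³ n a b = starEdge (n ∸ 4) a b ⊎ (a ≡ n ∸ 4 × b ≡ n ∸ 3)
         ⊎ (a ≡ n ∸ 4 × b ≡ n ∸ 2) ⊎ (a ≡ n ∸ 4 × b ≡ n ∸ 1)

-- Write n = 10 + k, so that 2n − 9 = 11 + 2k, and let H be the complement of G.
--
-- Lower bound: two disjoint cliques with at most 5 + k vertices each contain no K_{1,5+k}, hence
-- no T′_{n−3}; their complement is bipartite with parts of at most 5 + k vertices, so it contains no
-- K_{1,6+k}, hence none of T″_n, T‴_n, T³_n.
--
-- Upper bound, for G on 11 + 2k vertices. Each of the three trees is a star K_{1,6+k} with three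
-- pendant vertices hung from its leaves, so it lies in K_{4,6+k}. If a vertex v has G-degree ≥ 6 + k,
-- then either a path v–u–w with w ≠ v yields T′_{n−3} ⊆ G, or v is the only neighbour of each of its
-- neighbours, and four of them together with 6 + k other vertices form a K_{4,6+k} in H. If v has degree
-- exactly 5 + k, the same holds with paths leaving N[v], the biclique now joining four non-neighbours
-- of v to N[v]. Otherwise every G-degree is ≤ 4 + k. Take v₀ of maximum degree, a set L of 6 + k
-- H-neighbours of v₀, and the set Z of the 4 + k remaining vertices. Maximality of deg v₀ shows that
-- each z ∈ Z has at most 3 + k G-neighbours, hence at least 3 H-neighbours, in L. Greedy choices
-- then give T‴_n in H, while double counting the H-edges between Z and L (3|Z| > |L| and, for k ≥ 1,
-- 3|Z| > 2|L|) gives a vertex of L with two, resp. three, H-neighbours in Z, and thus T″_n, resp. T³_n.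
module Submission where

open import Defs
open import Data.Nat using (ℕ; zero; suc; _+_; _*_; _∸_; _≤_; _<_; _<?_; _≤?_; _<ᵇ_; z≤n; s≤s)
open import Data.Product using (_×_; ∃-syntax; _,_; proj₁; proj₂)

open import Data.Bool using (Bool; true; false; not; _∧_; _∨_; _xor_; T)
open import Data.Bool.Properties using (∧-zeroʳ; ∧-identityʳ; not-involutive; ¬-not; xor-comm)
  renaming (_≟_ to _≟ᵇ_)
open import Data.Empty using (⊥; ⊥-elim)
open import Data.Fin using (Fin; zero; suc; toℕ; fromℕ<; inject≤; _≟_)
open import Data.Fin.Properties
  using (any?; toℕ-injective; toℕ<n; pigeonhole; toℕ-fromℕ<; suc-injective; inject≤-injective; toℕ-inject≤)
open import Data.List using (List; []; _∷_; _++_; length; allFin)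
open import Data.List.Extrema.Nat using (argmax; f[xs]≤f[argmax])
open import Data.List.Membership.Propositional using (_∈_)
open import Data.List.Membership.Propositional.Properties using (∈-allFin)
open import Data.List.Properties using (length-++)
open import Data.List.Relation.Unary.All as All using (All; []; _∷_)
open import Data.List.Relation.Unary.All.Properties using (All¬⇒¬Any; ¬Any⇒All¬; ++⁺)
open import Data.List.Relation.Unary.All.Properties.Core using (All-swap)
open import Data.List.Relation.Unary.AllPairs using ([]; _∷_)
import Data.List.Relation.Unary.AllPairs.Properties as AllPairs
open import Data.List.Relation.Unary.Any using (here; there)
open import Data.List.Relation.Unary.Unique.Propositional using (Unique)
open import Data.Nat.Properties
  using ( ≤-refl; ≤-reflexive; ≤-trans; ≤-pred; n≤1+n; n<1+n; m≤m+n; m≤n+m; ≰⇒>; ≮⇒≥; <⇒≱; <⇒≢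
        ; +-comm; +-suc; +-identityʳ; *-identityʳ; *-zeroʳ; +-mono-≤; +-monoˡ-≤; +-monoʳ-≤; *-monoʳ-≤
        ; +-cancelˡ-≤; +-cancelʳ-≤; +-cancelˡ-<; m+n∸m≡n; m+n∸n≡m; m+n≤o⇒m≤o∸n; ∸-monoˡ-<; ∸-cancelʳ-≡
        ; <ᵇ⇒<; <⇒<ᵇ; m≤n⇒∃[o]m+o≡n; +-*-semiring; module ≤-Reasoning )
open import Data.Nat.Tactic.RingSolver using (solve-∀)
open import Algebra.Properties.Semiring.Sum +-*-semiring
  using (sum; ∑-comm; ∑-distrib-+; sum-cong-≗; *-distribˡ-sum)
open import Data.Sum as Sum using (_⊎_; inj₁; inj₂)
open import Data.Unit using (tt)
open import Function using (_∘_)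
open import Function.Definitions using (Injective)
open import Relation.Binary.PropositionalEquality
open import Relation.Nullary using (¬_; ¬?; yes; no; does; _×-dec_)
open import Relation.Nullary.Decidable using (dec-true; dec-false; decidable-stable)

separated : ∀ {A : Set} (Q : A → Bool) {x y} → Q x ≡ true → Q y ≡ false → x ≢ y
separated Q Qx Qy refl with () ← trans (sym Qx) Qy

∧-true⁻ : ∀ {a b} → a ∧ b ≡ true → a ≡ true × b ≡ true
∧-true⁻ {true} b≡true = refl , b≡true

∧-true⁺ : ∀ {a b} → a ≡ true → b ≡ true → a ∧ b ≡ true
∧-true⁺ refl refl = refl

-- Counting over Fin N

ind : Bool → ℕ
ind true  = 1
ind false = 0

opaque
  count : ∀ {N} → (Fin N → Bool) → ℕ
  count P = sum (ind ∘ P)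

_∖[_] : ∀ {N} → (Fin N → Bool) → Fin N → (Fin N → Bool)
(P ∖[ e ]) x = P x ∧ not (does (x ≟ e))

private
  sum-mono : ∀ {N} {f g : Fin N → ℕ} → (∀ i → f i ≤ g i) → sum f ≤ sum g
  sum-mono {zero}  f≤g = z≤n
  sum-mono {suc N} f≤g = +-mono-≤ (f≤g zero) (sum-mono (f≤g ∘ suc))

  sum-zero : ∀ N → sum {N} (λ _ → 0) ≡ 0
  sum-zero zero    = refl
  sum-zero (suc N) = sum-zero N

opaque
  unfolding count

  count-cong : ∀ {N} {P Q : Fin N → Bool} → (∀ x → P x ≡ Q x) → count P ≡ count Q
  count-cong P≗Q = sum-cong-≗ (cong ind ∘ P≗Q)

  count-false : ∀ N → count {N} (λ _ → false) ≡ 0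
  count-false = sum-zero

  count-mono : ∀ {N} {P Q : Fin N → Bool} → (∀ x → P x ≡ true → Q x ≡ true) → count P ≤ count Q
  count-mono P⇒Q = sum-mono λ x → ind-mono (P⇒Q x)
    where
      ind-mono : ∀ {a b} → (a ≡ true → b ≡ true) → ind a ≤ ind b
      ind-mono {false} _   = z≤n
      ind-mono {true}  a⇒b rewrite a⇒b refl = ≤-refl

  count>0⇒∃ : ∀ {N} (P : Fin N → Bool) → 0 < count P → ∃[ x ] P x ≡ true
  count>0⇒∃ {suc N} P pos with P zero in P0
  ... | true  = zero , P0
  ... | false = let x , Px = count>0⇒∃ (P ∘ suc) pos in suc x , Px

  count+count-not : ∀ {N} (P : Fin N → Bool) → count P + count (not ∘ P) ≡ N
  count+count-not {zero}  P = refl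
  count+count-not {suc N} P with P zero
  ... | true  = cong suc (count+count-not (P ∘ suc))
  ... | false = trans (+-suc _ _) (cong suc (count+count-not (P ∘ suc)))

  count-split : ∀ {N} (P Q : Fin N → Bool) →
                count P ≡ count (λ x → P x ∧ Q x) + count (λ x → P x ∧ not (Q x))
  count-split P Q = trans (sum-cong-≗ λ x → split (P x) (Q x))
    (∑-distrib-+ (λ x → ind (P x ∧ Q x)) (λ x → ind (P x ∧ not (Q x))))
    where
      split : ∀ a b → ind a ≡ ind (a ∧ b) + ind (a ∧ not b)
      split false _     = refl
      split true  true  = refl
      split true  false = refl

  count-single : ∀ {N} (P : Fin N → Bool) e → count (λ x → P x ∧ does (x ≟ e)) ≡ ind (P e)
  count-single {suc N} P zero = trans
    (cong₂ _+_ (cong ind (∧-identityʳ (P zero)))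
               (trans (sum-cong-≗ λ x → cong ind (∧-zeroʳ (P (suc x)))) (sum-zero N)))
    (+-identityʳ _)
  count-single {suc N} P (suc e) = cong₂ _+_ (cong ind (∧-zeroʳ (P zero))) (count-single (P ∘ suc) e)

  double-counting : ∀ {m n} (A : Fin m → Bool) (B : Fin n → Bool) (R : Fin m → Fin n → Bool) {lo hi} →
                    (∀ a → A a ≡ true → lo ≤ count (λ b → B b ∧ R a b)) →
                    (∀ b → B b ≡ true → count (λ a → A a ∧ R a b) ≤ hi) →
                    lo * count A ≤ hi * count B
  double-counting A B R {lo} {hi} A-lo B-hi = begin
    lo * count A
      ≡⟨ *-distribˡ-sum lo (ind ∘ A) ⟩
    sum (λ a → lo * ind (A a))
      ≤⟨ sum-mono (λ a → lower (A a) {λ b → B b ∧ R a b} (A-lo a)) ⟩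
    sum (λ a → count (λ b → A a ∧ (B b ∧ R a b)))
      ≡⟨ ∑-comm (λ a b → ind (A a ∧ (B b ∧ R a b))) ⟩
    sum (λ b → sum (λ a → ind (A a ∧ (B b ∧ R a b))))
      ≡⟨ sum-cong-≗ (λ b → sum-cong-≗ λ a → cong ind (∧-swap (A a) (B b) (R a b))) ⟩
    sum (λ b → count (λ a → B b ∧ (A a ∧ R a b)))
      ≤⟨ sum-mono (λ b → upper (B b) {λ a → A a ∧ R a b} (B-hi b)) ⟩
    sum (λ b → hi * ind (B b))
      ≡⟨ *-distribˡ-sum hi (ind ∘ B) ⟨
    hi * count B
      ∎
    where
      open ≤-Reasoning
      ∧-swap : ∀ x y z → x ∧ (y ∧ z) ≡ y ∧ (x ∧ z)
      ∧-swap false false _ = refl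
      ∧-swap false true  _ = refl
      ∧-swap true  _     _ = refl
      lower : ∀ {k} c {X : Fin k → Bool} → (c ≡ true → lo ≤ count X) → lo * ind c ≤ count (λ i → c ∧ X i)
      lower true  lo≤ = ≤-trans (≤-reflexive (*-identityʳ lo)) (lo≤ refl)
      lower false _   = ≤-trans (≤-reflexive (*-zeroʳ lo)) z≤n
      upper : ∀ {k} c {X : Fin k → Bool} → (c ≡ true → count X ≤ hi) → count (λ i → c ∧ X i) ≤ hi * ind c
      upper     true  ≤hi = ≤-trans (≤hi refl) (≤-reflexive (sym (*-identityʳ hi)))
      upper {k} false _   = ≤-reflexive (trans (sum-zero k) (sym (*-zeroʳ hi)))

count-not : ∀ {N} (P : Fin N → Bool) → count (not ∘ P) ≡ N ∸ count P
count-not {N} P = sym (trans (cong (_∸ count P) (sym (count+count-not P))) (m+n∸m≡n (count P) _))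

count-true : ∀ N → count {N} (λ _ → true) ≡ N
count-true N = trans (count-not (λ _ → false)) (cong (N ∸_) (count-false N))

count-remove : ∀ {N} (P : Fin N → Bool) e → count P ≡ ind (P e) + count (P ∖[ e ])
count-remove P e = trans (count-split P (λ x → does (x ≟ e))) (cong (_+ count (P ∖[ e ])) (count-single P e))

double-counting-∃ : ∀ {m n} (A : Fin m → Bool) (B : Fin n → Bool) (R : Fin m → Fin n → Bool) {lo hi} →
                    hi * count B < lo * count A →
                    (∀ a → A a ≡ true → lo ≤ count (λ b → B b ∧ R a b)) →
                    ∃[ b ] B b ≡ true × hi < count (λ a → A a ∧ R a b)
double-counting-∃ A B R {lo} {hi} B<A A-lo
  with any? (λ b → (B b ≟ᵇ true) ×-dec (hi <? count (λ a → A a ∧ R a b)))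
... | yes found = found
... | no  none  = ⊥-elim (<⇒≱ B<A (double-counting A B R A-lo λ b Bb → ≮⇒≥ λ hi< → none (b , Bb , hi<)))

-- Choosing distinct vertices

module _ {N : ℕ} where
  open import Data.List.Membership.DecPropositional (_≟_ {N}) using (_∈?_)

  _∈ᵇ_ : Fin N → List (Fin N) → Bool
  x ∈ᵇ L = does (x ∈? L)

  _∖_ : (Fin N → Bool) → List (Fin N) → (Fin N → Bool)
  (Q ∖ L) x = Q x ∧ not (x ∈ᵇ L)

  ∈ᵇ⇒∈ : ∀ {x} L → x ∈ᵇ L ≡ true → x ∈ L
  ∈ᵇ⇒∈ {x} L _ with x ∈? L
  ... | yes x∈L = x∈L

  ∉⇒∈ᵇ≡false : ∀ {x} L → All (x ≢_) L → x ∈ᵇ L ≡ false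
  ∉⇒∈ᵇ≡false {x} L x∉L = dec-false (x ∈? L) (All¬⇒¬Any x∉L)

  ∈ᵇ≡false⇒∉ : ∀ {x} L → x ∈ᵇ L ≡ false → All (x ≢_) L
  ∈ᵇ≡false⇒∉ {x} L _ with x ∈? L
  ... | no x∉L = ¬Any⇒All¬ L x∉L

  count-∈ᵇ : ∀ {L} → Unique L → count (_∈ᵇ L) ≡ length L
  count-∈ᵇ {[]}    []           = count-false N
  count-∈ᵇ {y ∷ L} (y∉L ∷ uL) = begin
    count (_∈ᵇ (y ∷ L))
      ≡⟨ count-remove (_∈ᵇ (y ∷ L)) y ⟩
    ind (y ∈ᵇ (y ∷ L)) + count ((_∈ᵇ (y ∷ L)) ∖[ y ])
      ≡⟨ cong₂ _+_ (cong (λ b → ind (b ∨ y ∈ᵇ L)) (dec-true (y ≟ y) refl)) (count-cong without-y) ⟩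
    1 + count (_∈ᵇ L)
      ≡⟨ cong suc (count-∈ᵇ uL) ⟩
    suc (length L)
      ∎
    where
      open ≡-Reasoning
      without-y : ∀ x → ((_∈ᵇ (y ∷ L)) ∖[ y ]) x ≡ x ∈ᵇ L
      without-y x with x ≟ y
      ... | yes refl = sym (∉⇒∈ᵇ≡false L y∉L)
      ... | no  _    = ∧-identityʳ (x ∈ᵇ L)

  count-∖ : ∀ Q L → count Q ≤ length L + count (Q ∖ L)
  count-∖ Q []      = count-mono λ x Qx → trans (∧-identityʳ (Q x)) Qx
  count-∖ Q (y ∷ L) = begin
    count Q
      ≤⟨ count-∖ Q L ⟩
    length L + count (Q ∖ L)
      ≡⟨ cong (length L +_) (count-remove (Q ∖ L) y) ⟩
    length L + (ind ((Q ∖ L) y) + count ((Q ∖ L) ∖[ y ]))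
      ≤⟨ +-monoʳ-≤ (length L) (+-mono-≤ (ind≤1 _) (count-mono ∖∷)) ⟩
    length L + suc (count (Q ∖ (y ∷ L)))
      ≡⟨ +-suc (length L) _ ⟩
    length (y ∷ L) + count (Q ∖ (y ∷ L))
      ∎
    where
      open ≤-Reasoning
      ind≤1 : ∀ b → ind b ≤ 1
      ind≤1 true  = ≤-refl
      ind≤1 false = z≤n
      ∖∷ : ∀ x → ((Q ∖ L) ∖[ y ]) x ≡ true → (Q ∖ (y ∷ L)) x ≡ true
      ∖∷ x _ with x ≟ y | x ∈? L | Q x
      ... | no _ | no _ | true = refl

  ∖-sound : ∀ Q L {x} → (Q ∖ L) x ≡ true → Q x ≡ true × All (x ≢_) L
  ∖-sound Q L {x} Q∖Lx with x ∈? L | ∧-true⁻ {Q x} Q∖Lx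
  ... | no x∉L | Qx , _ = Qx , ¬Any⇒All¬ L x∉L

  record Selection (Q : Fin N → Bool) (L : List (Fin N)) (m : ℕ) : Set where
    field
      elems   : List (Fin N)
      length≡ : length elems ≡ m
      satisfy : All (λ x → Q x ≡ true) elems
      unique  : Unique elems
      avoids  : All (λ x → All (x ≢_) L) elems

  opaque
    pick : (Q : Fin N → Bool) (L : List (Fin N)) → length L < count Q → ∃[ x ] Q x ≡ true × All (x ≢_) L
    pick Q L L<Q =
      let x , x∈Q∖L = count>0⇒∃ (Q ∖ L) (+-cancelˡ-< (length L) 0 _ (begin-strict
            length L + 0             ≡⟨ +-identityʳ (length L) ⟩
            length L                 <⟨ L<Q ⟩
            count Q                  ≤⟨ count-∖ Q L ⟩
            length L + count (Q ∖ L) ∎))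
      in x , ∖-sound Q L x∈Q∖L
      where open ≤-Reasoning

    select : ∀ (Q : Fin N → Bool) L m → m + length L ≤ count Q → Selection Q L m
    select Q L zero    _ = record { elems = [] ; length≡ = refl ; satisfy = [] ; unique = [] ; avoids = [] }
    select Q L (suc m) h =
      let x , Qx , x∉L = pick Q L (≤-trans (s≤s (m≤n+m (length L) m)) h)
          S = select Q (x ∷ L) m (≤-trans (≤-reflexive (+-suc m (length L))) h)
          open Selection S
      in record
        { elems   = x ∷ elems
        ; length≡ = cong suc length≡
        ; satisfy = Qx ∷ satisfy
        ; unique  = All.map (λ { (y≢x ∷ _) → ≢-sym y≢x }) avoids ∷ unique
        ; avoids  = x∉L ∷ All.map (λ { (_ ∷ y∉L) → y∉L }) avoids
        }

  Selection-avoid : ∀ {Q L m w} → (∀ {x} → Q x ≡ true → x ≢ w) → Selection Q L m → Selection Q (w ∷ L) m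
  Selection-avoid Q⇒≢w S = record
    { elems = elems ; length≡ = length≡ ; satisfy = satisfy ; unique = unique
    ; avoids = All.zipWith (λ (Qx , x∉L) → Q⇒≢w Qx ∷ x∉L) (satisfy , avoids) }
    where open Selection S

unique-++ : ∀ {A : Set} {xs ys : List A} → Unique xs → Unique ys →
            All (λ y → All (y ≢_) xs) ys → Unique (xs ++ ys)
unique-++ uxs uys ys∉xs = AllPairs.++⁺ uxs uys (All.map (All.map ≢-sym) (All-swap ys∉xs))

unique-∷ʳ : ∀ {A : Set} {xs : List A} {x} → Unique xs → All (x ≢_) xs → Unique (xs ++ x ∷ [])
unique-∷ʳ uxs x∉xs = unique-++ uxs ([] ∷ []) (x∉xs ∷ [])

-- Past the end of the list, nth d returns the default d.
nth : ∀ {A : Set} → A → List A → ℕ → A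
nth d []       _       = d
nth d (x ∷ xs) zero    = x
nth d (x ∷ xs) (suc i) = nth d xs i

module _ {A : Set} (d : A) where

  nth-++ˡ : ∀ xs ys {i} → i < length xs → nth d (xs ++ ys) i ≡ nth d xs i
  nth-++ˡ (x ∷ xs) ys {zero}  _        = refl
  nth-++ˡ (x ∷ xs) ys {suc i} (s≤s i<) = nth-++ˡ xs ys i<

  nth-++ʳ : ∀ xs ys i → nth d (xs ++ ys) (i + length xs) ≡ nth d ys i
  nth-++ʳ []       ys i = cong (nth d ys) (+-identityʳ i)
  nth-++ʳ (x ∷ xs) ys i = trans (cong (nth d (x ∷ xs ++ ys)) (+-suc i (length xs))) (nth-++ʳ xs ys i)

  nth-∷ʳ : ∀ xs {x m} → length xs ≡ m → nth d (xs ++ x ∷ []) m ≡ x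
  nth-∷ʳ xs refl = nth-++ʳ xs _ 0

  nth-∈ : ∀ xs {i} → i < length xs → nth d xs i ∈ xs
  nth-∈ (x ∷ xs) {zero}  _        = here refl
  nth-∈ (x ∷ xs) {suc i} (s≤s i<) = there (nth-∈ xs i<)

  nth-All : ∀ {P : A → Set} {xs i} → All P xs → i < length xs → P (nth d xs i)
  nth-All {xs = xs} Pxs i< = All.lookup Pxs (nth-∈ xs i<)

  nth-injective : ∀ {xs} → Unique xs → ∀ {i j} → i < length xs → j < length xs →
                  nth d xs i ≡ nth d xs j → i ≡ j
  nth-injective {x ∷ xs} _         {zero}  {zero}  _        _        _  = refl
  nth-injective {x ∷ xs} (x∉ ∷ _)  {zero}  {suc j} _        (s≤s j<) x≡ = ⊥-elim (All.lookup x∉ (nth-∈ xs j<) x≡)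
  nth-injective {x ∷ xs} (x∉ ∷ _)  {suc i} {zero}  (s≤s i<) _        ≡x = ⊥-elim (All.lookup x∉ (nth-∈ xs i<) (sym ≡x))
  nth-injective {x ∷ xs} (_ ∷ uxs) {suc i} {suc j} (s≤s i<) (s≤s j<) eq = cong suc (nth-injective uxs i< j< eq)

deg : ∀ {N} → SimpleGraph N → Fin N → ℕ
deg G v = count (adj G v)

module _ {N : ℕ} (G : SimpleGraph N) where

  adj⇒≢ : ∀ {x y} → adj G x y ≡ true → x ≢ y
  adj⇒≢ {x} Gxy refl with () ← trans (sym Gxy) (adj-irrefl G x)

  complement-adj⁺ : ∀ {x y} → x ≢ y → adj G x y ≡ false → adj (complement G) x y ≡ true
  complement-adj⁺ {x} {y} x≢y Gxy with x ≟ y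
  ... | yes x≡y = ⊥-elim (x≢y x≡y)
  ... | no  _   = cong not Gxy

  complement-adj⁻ : ∀ {x y} → adj (complement G) x y ≡ true → adj G x y ≡ false
  complement-adj⁻ {x} {y} Hxy with x ≟ y
  ... | no _ = trans (sym (not-involutive _)) (cong not Hxy)

  deg-complement : ∀ v → suc (deg G v + deg (complement G) v) ≡ N
  deg-complement v = begin
    suc (deg G v + deg (complement G) v)           ≡⟨ cong₂ (λ a b → suc (a + b)) deg≡ (count-cong complement-not) ⟩
    suc (count (adj G v ∖[ v ])) + count (not ∘ Q) ≡⟨ cong (_+ count (not ∘ Q)) Q-count ⟨
    count Q + count (not ∘ Q)                      ≡⟨ count+count-not Q ⟩
    N                                              ∎
    where
      open ≡-Reasoning
      Q : Fin N → Bool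
      Q x = does (x ≟ v) ∨ adj G v x
      complement-not : ∀ x → adj (complement G) v x ≡ not (Q x)
      complement-not x with v ≟ x | x ≟ v
      ... | yes _   | yes _   = refl
      ... | no  _   | no  _   = refl
      ... | yes v≡x | no  x≢v = ⊥-elim (x≢v (sym v≡x))
      ... | no  v≢x | yes x≡v = ⊥-elim (v≢x (sym x≡v))
      deg≡ : deg G v ≡ count (adj G v ∖[ v ])
      deg≡ = trans (count-remove (adj G v) v) (cong (λ b → ind b + count (adj G v ∖[ v ])) (adj-irrefl G v))
      same : ∀ x → (Q ∖[ v ]) x ≡ (adj G v ∖[ v ]) x
      same x with x ≟ v
      ... | yes _ = sym (∧-zeroʳ (adj G v x))
      ... | no  _ = refl
      Q-count : count Q ≡ suc (count (adj G v ∖[ v ]))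
      Q-count = trans (count-remove Q v)
        (cong₂ _+_ (cong (λ b → ind (b ∨ adj G v v)) (dec-true (v ≟ v) refl)) (count-cong same))

  deg-complement-≥ : ∀ v {a b} → deg G v ≤ a → suc (a + b) ≤ N → b ≤ deg (complement G) v
  deg-complement-≥ v {a} {b} dv≤a N≥ = +-cancelˡ-≤ a b _ (begin
    a + b                          ≤⟨ ≤-pred (≤-trans N≥ (≤-reflexive (sym (deg-complement v)))) ⟩
    deg G v + deg (complement G) v ≤⟨ +-monoˡ-≤ _ dv≤a ⟩
    a + deg (complement G) v       ∎)
    where open ≤-Reasoning

  deg-complement-≤ : ∀ v {a b} → b ≤ deg (complement G) v → N ≤ suc (a + b) → deg G v ≤ a
  deg-complement-≤ v {a} {b} b≤dv N≤ = +-cancelʳ-≤ b _ a (begin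
    deg G v + b                    ≤⟨ +-monoʳ-≤ (deg G v) b≤dv ⟩
    deg G v + deg (complement G) v ≤⟨ ≤-pred (≤-trans (≤-reflexive (deg-complement v)) N≤) ⟩
    a + b                          ∎)
    where open ≤-Reasoning

  Contains-⇒ : ∀ {k} {E E′ : ℕ → ℕ → Set} → (∀ {a b} → E a b → E′ a b) → Contains G k E′ → Contains G k E
  Contains-⇒ E⇒E′ (f , f-inj , f-adj) = f , f-inj , λ i j e → f-adj i j (E⇒E′ {toℕ i} {toℕ j} e)

  nth-Contains : ∀ {k} {E : ℕ → ℕ → Set} (d : Fin N) (L : List (Fin N)) → length L ≡ k → Unique L →
                 (∀ {a b} → E a b → adj G (nth d L a) (nth d L b) ≡ true) → Contains G k E
  nth-Contains d L refl uL L-adj =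
      (λ i → nth d L (toℕ i))
    , (λ {i} {j} eq → toℕ-injective (nth-injective d uL (toℕ<n i) (toℕ<n j) eq))
    , (λ i j → L-adj {toℕ i} {toℕ j})

  Contains-star : ∀ {k m} → m < k → Contains G k (starEdge m) →
                  ∃[ g ] Injective _≡_ _≡_ g × (∀ i → adj G (g zero) (g (suc i)) ≡ true)
  Contains-star {m = m} m<k (f , f-inj , f-adj) =
      (λ i → f (inject≤ i m<k))
    , (λ {i} {j} eq → inject≤-injective m<k m<k i j (f-inj eq))
    , λ i → f-adj _ _ ( toℕ-inject≤ zero m<k
                      , subst (1 ≤_) (sym (toℕ-inject≤ (suc i) m<k)) (s≤s z≤n)
                      , subst (_≤ m) (sym (toℕ-inject≤ (suc i) m<k)) (toℕ<n i) )

-- Stars with pendant vertices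

-- Centre 0, leaves 1 … m, and pendant vertices m + 1 … m + p; the pendant m + 1 + t hangs from
-- the leaf 1 + attach t.
data StarWithPendants (m p : ℕ) (attach : ℕ → ℕ) : ℕ → ℕ → Set where
  leaf    : ∀ {b} → b < m → StarWithPendants m p attach 0 (suc b)
  pendant : ∀ {t} → t < p → attach t < m → StarWithPendants m p attach (suc (attach t)) (suc (t + m))

record Biclique {N : ℕ} (G : SimpleGraph N) (a b : ℕ) : Set where
  field
    left right   : List (Fin N)
    length-left  : length left ≡ a
    length-right : length right ≡ b
    unique-left  : Unique left
    unique-right : Unique right
    complete     : All (λ x → All (λ y → adj G x y ≡ true) right) left

module _ {N : ℕ} (G : SimpleGraph N) {m p : ℕ} {attach : ℕ → ℕ} where

  StarWithPendants-Contains :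
    (v : Fin N) (Bs Ps : List (Fin N)) → length Bs ≡ m → length Ps ≡ p → Unique (v ∷ Bs ++ Ps) →
    All (λ b → adj G v b ≡ true) Bs →
    (∀ {t} → t < p → attach t < m → adj G (nth v Bs (attach t)) (nth v Ps t) ≡ true) →
    Contains G (suc (p + m)) (StarWithPendants m p attach)
  StarWithPendants-Contains v Bs Ps refl refl uL v-Bs Bs-Ps =
    nth-Contains G {E = StarWithPendants m p attach} v (v ∷ Bs ++ Ps)
      (cong suc (trans (length-++ Bs) (+-comm (length Bs) _))) uL edge
    where
      edge : ∀ {a b} → StarWithPendants m p attach a b →
             adj G (nth v (v ∷ Bs ++ Ps) a) (nth v (v ∷ Bs ++ Ps) b) ≡ true
      edge (leaf b<m) rewrite nth-++ˡ v Bs Ps b<m = nth-All v v-Bs b<m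
      edge (pendant {t} t<p at<m) rewrite nth-++ˡ v Bs Ps at<m | nth-++ʳ v Bs Ps t = Bs-Ps t<p at<m

  Biclique⇒StarWithPendants : Biclique G (suc p) m → Contains G (suc (p + m)) (StarWithPendants m p attach)
  Biclique⇒StarWithPendants record { left = [] ; length-left = () }
  Biclique⇒StarWithPendants record
    { left = v ∷ Ps ; right = Bs ; length-left = refl ; length-right = refl
    ; unique-left = v∉Ps ∷ uPs ; unique-right = uBs ; complete = v-Bs ∷ Ps-Bs } =
    StarWithPendants-Contains v Bs Ps refl refl
      (++⁺ (All.map (adj⇒≢ G) v-Bs) v∉Ps
        ∷ AllPairs.++⁺ uBs uPs (All.map (All.map (≢-sym ∘ adj⇒≢ G)) (All-swap Ps-Bs)))
      v-Bs
      (λ t<p at<m → trans (adj-sym G _ _) (nth-All v (nth-All v Ps-Bs t<p) at<m))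

starEdge⇒leaf : ∀ {m p attach a b} → starEdge m a b → StarWithPendants m p attach a b
starEdge⇒leaf (refl , s≤s z≤n , b≤m) = leaf b≤m

T′⇒StarWithPendants : ∀ m {a b} → T′ (3 + m) a b → StarWithPendants (1 + m) 1 (λ _ → 0) a b
T′⇒StarWithPendants m (inj₁ e)             = starEdge⇒leaf e
T′⇒StarWithPendants m (inj₂ (refl , refl)) = pendant (s≤s z≤n) (s≤s z≤n)

attach″ : ℕ → ℕ
attach″ 0 = 0
attach″ 1 = 0
attach″ _ = 1

T″⇒StarWithPendants : ∀ k {a b} → T″ (10 + k) a b → StarWithPendants (6 + k) 3 attach″ a b
T″⇒StarWithPendants k (inj₁ e)                            = starEdge⇒leaf e
T″⇒StarWithPendants k (inj₂ (inj₁ (refl , refl)))         = pendant {t = 0} (s≤s z≤n) (s≤s z≤n)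
T″⇒StarWithPendants k (inj₂ (inj₂ (inj₁ (refl , refl)))) = pendant {t = 1} (s≤s (s≤s z≤n)) (s≤s z≤n)
T″⇒StarWithPendants k (inj₂ (inj₂ (inj₂ (refl , refl)))) = pendant {t = 2} ≤-refl (s≤s (s≤s z≤n))

T‴⇒StarWithPendants : ∀ k {a b} → T‴ (10 + k) a b → StarWithPendants (6 + k) 3 (λ t → t) a b
T‴⇒StarWithPendants k (inj₁ e)                            = starEdge⇒leaf e
T‴⇒StarWithPendants k (inj₂ (inj₁ (refl , refl)))         = pendant {t = 0} (s≤s z≤n) (s≤s z≤n)
T‴⇒StarWithPendants k (inj₂ (inj₂ (inj₁ (refl , refl)))) = pendant {t = 1} (s≤s (s≤s z≤n)) (s≤s (s≤s z≤n))
T‴⇒StarWithPendants k (inj₂ (inj₂ (inj₂ (refl , refl)))) = pendant {t = 2} ≤-refl (s≤s (s≤s (s≤s z≤n)))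

T³⇒StarWithPendants : ∀ k {a b} → T³ (10 + k) a b → StarWithPendants (6 + k) 3 (λ _ → 5 + k) a b
T³⇒StarWithPendants k (inj₁ e)                            = starEdge⇒leaf e
T³⇒StarWithPendants k (inj₂ (inj₁ (refl , refl)))         = pendant {t = 0} (s≤s z≤n) ≤-refl
T³⇒StarWithPendants k (inj₂ (inj₂ (inj₁ (refl , refl)))) = pendant {t = 1} (s≤s (s≤s z≤n)) ≤-refl
T³⇒StarWithPendants k (inj₂ (inj₂ (inj₂ (refl , refl)))) = pendant {t = 2} ≤-refl ≤-refl

-- Vertices of large degree

module _ {N : ℕ} (G : SimpleGraph N) where

  private
    H = complement G

  T′-from-path : ∀ {m v u w} → adj G v u ≡ true → adj G u w ≡ true → w ≢ v →
                 Selection (adj G v) (w ∷ u ∷ []) m → Contains G (3 + m) (T′ (3 + m))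
  T′-from-path {m} {v} {u} {w} Gvu Guw w≢v R =
    Contains-⇒ G {E = T′ (3 + m)} (T′⇒StarWithPendants m)
      (StarWithPendants-Contains G v (u ∷ elems) (w ∷ []) (cong suc length≡) refl
        (++⁺ (All.map (adj⇒≢ G) (Gvu ∷ satisfy)) (≢-sym w≢v ∷ []) ∷ unique-∷ʳ leaves-unique w∉leaves)
        (Gvu ∷ satisfy)
        λ { {zero} _ _ → Guw ; {suc _} (s≤s ()) })
    where
      open Selection R
      leaves-unique : Unique (u ∷ elems)
      leaves-unique = All.map (λ { (_ ∷ x≢u ∷ []) → ≢-sym x≢u }) avoids ∷ unique
      w∉leaves : All (w ≢_) (u ∷ elems)
      w∉leaves = ≢-sym (adj⇒≢ G Guw) ∷ All.map (λ { (x≢w ∷ _) → ≢-sym x≢w }) avoids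

  isolated-neighbourhood⇒Biclique : ∀ k v → 4 ≤ deg G v → 11 + k ≤ N →
    (∀ {u w} → adj G v u ≡ true → adj G u w ≡ true → w ≡ v) → Biclique H 4 (6 + k)
  isolated-neighbourhood⇒Biclique k v dv N≥ closed = record
    { left = elems ps ; right = elems bs ; length-left = length≡ ps ; length-right = length≡ bs
    ; unique-left = unique ps ; unique-right = unique bs
    ; complete = All-swap (All.map (λ { (b≢v ∷ b∉ps) → All.zipWith (H-adjacent b≢v) (b∉ps , satisfy ps) }) (avoids bs))
    }
    where
      open Selection
      ps : Selection (adj G v) [] 4
      ps = select (adj G v) [] 4 dv
      bs : Selection (λ _ → true) (v ∷ elems ps) (6 + k)
      bs = select (λ _ → true) (v ∷ elems ps) (6 + k) (begin
        6 + k + suc (length (elems ps)) ≡⟨ cong (λ l → 6 + k + suc l) (length≡ ps) ⟩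
        6 + k + 5                       ≡⟨ +-comm (6 + k) 5 ⟩
        11 + k                          ≤⟨ N≥ ⟩
        N                               ≡⟨ count-true N ⟨
        count (λ _ → true)              ∎)
        where open ≤-Reasoning
      H-adjacent : ∀ {b p} → b ≢ v → b ≢ p × adj G v p ≡ true → adj H p b ≡ true
      H-adjacent b≢v (b≢p , Gvp) = complement-adj⁺ G (≢-sym b≢p) (¬-not (b≢v ∘ closed Gvp))

  closed-neighbourhood⇒Biclique : ∀ k v → 5 + k ≤ deg G v → deg G v ≤ 5 + k → 10 + k ≤ N →
    (∀ {u w} → adj G v u ≡ true → adj G u w ≡ true → w ≢ v → adj G v w ≡ true) → Biclique H 4 (6 + k)
  closed-neighbourhood⇒Biclique k v dv≥ dv≤ N≥ closed = record
    { left = elems ps ; right = v ∷ elems rs ; length-left = length≡ ps ; length-right = cong suc (length≡ rs)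
    ; unique-left = unique ps ; unique-right = All.map (adj⇒≢ G) (satisfy rs) ∷ unique rs
    ; complete = All.map (λ Hvp → trans (adj-sym H _ v) Hvp ∷ All.map (H-adjacent Hvp) (satisfy rs)) (satisfy ps)
    }
    where
      open Selection
      ps : Selection (adj H v) [] 4
      ps = select (adj H v) [] 4 (deg-complement-≥ G v dv≤ (≤-trans (≤-reflexive (cong suc (+-comm (5 + k) 4))) N≥))
      rs : Selection (adj G v) [] (5 + k)
      rs = select (adj G v) [] (5 + k) (≤-trans (≤-reflexive (+-identityʳ (5 + k))) dv≥)
      H-adjacent : ∀ {p r} → adj H v p ≡ true → adj G v r ≡ true → adj H p r ≡ true
      H-adjacent {p} {r} Hvp Gvr =
        complement-adj⁺ G (separated (adj G v) Gvr (complement-adj⁻ G Hvp) ∘ sym)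
          (trans (adj-sym G p r) (¬-not λ Grp →
            separated (adj G v) (closed Gvr Grp (≢-sym (adj⇒≢ H Hvp))) (complement-adj⁻ G Hvp) refl))

  high-degree : ∀ k v → 6 + k ≤ deg G v → 11 + k ≤ N → Contains G (7 + k) (T′ (7 + k)) ⊎ Biclique H 4 (6 + k)
  high-degree k v dv N≥
    with any? (λ u → any? (λ w → (adj G v u ≟ᵇ true) ×-dec (adj G u w ≟ᵇ true) ×-dec ¬? (w ≟ v)))
  ... | yes (u , w , Gvu , Guw , w≢v) =
    inj₁ (T′-from-path Gvu Guw w≢v (select (adj G v) (w ∷ u ∷ []) (4 + k) (≤-trans (≤-reflexive (+-comm (4 + k) 2)) dv)))
  ... | no ∄path =
    inj₂ (isolated-neighbourhood⇒Biclique k v (≤-trans (m≤m+n 4 (2 + k)) dv) N≥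
      λ {u} {w} Gvu Guw → decidable-stable (w ≟ v) λ w≢v → ∄path (u , w , Gvu , Guw , w≢v))

  critical-degree : ∀ k v → 5 + k ≤ deg G v → deg G v ≤ 5 + k → 10 + k ≤ N →
                    Contains G (7 + k) (T′ (7 + k)) ⊎ Biclique H 4 (6 + k)
  critical-degree k v dv≥ dv≤ N≥
    with any? (λ u → any? (λ w →
           (adj G v u ≟ᵇ true) ×-dec (adj G u w ≟ᵇ true) ×-dec ¬? (w ≟ v) ×-dec (adj G v w ≟ᵇ false)))
  ... | yes (u , w , Gvu , Guw , w≢v , ¬Gvw) =
    inj₁ (T′-from-path Gvu Guw w≢v
      (Selection-avoid (λ Gvx → separated (adj G v) Gvx ¬Gvw)
        (select (adj G v) (u ∷ []) (4 + k) (≤-trans (≤-reflexive (+-comm (4 + k) 1)) dv≥))))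
  ... | no ∄path =
    inj₂ (closed-neighbourhood⇒Biclique k v dv≥ dv≤ N≥
      λ {u} {w} Gvu Guw w≢v → ¬-not λ ¬Gvw → ∄path (u , w , Gvu , Guw , w≢v , ¬Gvw))

-- Maximum degree at most 4 + k

1*[6+k]<3*[4+k] : ∀ k → 1 * (6 + k) < 3 * (4 + k)
1*[6+k]<3*[4+k] k = subst (1 * (6 + k) <_) (sym (eq k)) (m≤m+n (suc (1 * (6 + k))) (5 + 2 * k))
  where
    eq : ∀ k → 3 * (4 + k) ≡ suc (1 * (6 + k)) + (5 + 2 * k)
    eq = solve-∀

2*[6+k]<3*[4+k] : ∀ {k} → 1 ≤ k → 2 * (6 + k) < 3 * (4 + k)
2*[6+k]<3*[4+k] {suc j} _ = subst (2 * (6 + suc j) <_) (sym (eq j)) (m≤m+n (suc (2 * (6 + suc j))) j)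
  where
    eq : ∀ j → 3 * (4 + suc j) ≡ suc (2 * (6 + suc j)) + j
    eq = solve-∀

module LowMaxDegree {N : ℕ} (G : SimpleGraph N) (k : ℕ) (N≡ : N ≡ suc ((4 + k) + (6 + k)))
                    (v₀ : Fin N) (v₀-max : ∀ w → deg G w ≤ deg G v₀) (Δ≤ : ∀ w → deg G w ≤ 4 + k) where

  H = complement G

  Leaves : Selection (adj H v₀) [] (6 + k)
  Leaves = select (adj H v₀) [] (6 + k)
    (≤-trans (≤-reflexive (+-identityʳ (6 + k))) (deg-complement-≥ G v₀ (Δ≤ v₀) (≤-reflexive (sym N≡))))

  open Selection Leaves using () renaming (elems to L; length≡ to length-L; satisfy to v₀-L; unique to unique-L)

  inL outside : Fin N → Bool
  inL x = x ∈ᵇ L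
  outside x = not (x ∈ᵇ (v₀ ∷ L))

  inL⇒adj : ∀ {x} → inL x ≡ true → adj H v₀ x ≡ true
  inL⇒adj = All.lookup v₀-L ∘ ∈ᵇ⇒∈ L

  outside⇒ : ∀ {z} → outside z ≡ true → z ≢ v₀ × inL z ≡ false
  outside⇒ {z} _ with z ≟ v₀ | z ∈ᵇ L
  ... | no z≢v₀ | false = z≢v₀ , refl

  count-inL : count inL ≡ 6 + k
  count-inL = trans (count-∈ᵇ unique-L) length-L

  count-outside : 4 + k ≤ count outside
  count-outside = begin
    4 + k                    ≤⟨ m+n≤o⇒m≤o∸n (4 + k) (≤-reflexive (trans (+-suc (4 + k) (6 + k)) (sym N≡))) ⟩
    N ∸ (7 + k)              ≡⟨ cong (N ∸_) (trans (count-∈ᵇ (All.map (adj⇒≢ H) v₀-L ∷ unique-L)) (cong suc length-L)) ⟨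
    N ∸ count (_∈ᵇ (v₀ ∷ L)) ≡⟨ count-not (_∈ᵇ (v₀ ∷ L)) ⟨
    count outside            ∎
    where open ≤-Reasoning

  L-neighbour Z-neighbour : Fin N → Fin N → Bool
  L-neighbour z x = inL x ∧ adj H z x
  Z-neighbour x z = outside z ∧ adj H z x

  L-neighbour⁻ : ∀ z x → L-neighbour z x ≡ true → inL x ≡ true × adj H x z ≡ true
  L-neighbour⁻ z x h = let Lx , Hzx = ∧-true⁻ {inL x} h in Lx , trans (adj-sym H x z) Hzx

  Z-neighbour⁻ : ∀ x z → Z-neighbour x z ≡ true → outside z ≡ true × adj H x z ≡ true
  Z-neighbour⁻ x z h = let Zz , Hzx = ∧-true⁻ {outside z} h in Zz , trans (adj-sym H x z) Hzx

  G-degree-into-L : ∀ {z} → outside z ≡ true → count (λ x → inL x ∧ adj G z x) ≤ 3 + k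
  G-degree-into-L {z} Zz with adj G z v₀ in Gzv₀
  ... | true = +-cancelˡ-≤ 1 _ _ (begin
    1 + count (λ x → inL x ∧ adj G z x)        ≤⟨ +-monoʳ-≤ 1 (count-mono avoid-v₀) ⟩
    1 + count (adj G z ∖[ v₀ ])                ≡⟨ cong (λ b → ind b + count (adj G z ∖[ v₀ ])) Gzv₀ ⟨
    ind (adj G z v₀) + count (adj G z ∖[ v₀ ]) ≡⟨ count-remove (adj G z) v₀ ⟨
    deg G z                                    ≤⟨ Δ≤ z ⟩
    4 + k                                      ∎)
    where
      open ≤-Reasoning
      avoid-v₀ : ∀ x → inL x ∧ adj G z x ≡ true → (adj G z ∖[ v₀ ]) x ≡ true
      avoid-v₀ x h = let Lx , Gzx = ∧-true⁻ {inL x} h in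
        ∧-true⁺ Gzx (cong not (dec-false (x ≟ v₀) (≢-sym (adj⇒≢ H (inL⇒adj Lx)))))
  -- Here z is an H-neighbour of v₀ outside L, so maximality of deg v₀ bounds every G-degree.
  ... | false = begin
    count (λ x → inL x ∧ adj G z x) ≤⟨ count-mono (λ x → proj₂ ∘ ∧-true⁻ {inL x}) ⟩
    deg G z                         ≤⟨ v₀-max z ⟩
    deg G v₀                        ≤⟨ deg-complement-≤ G v₀ v₀-H-degree
                                         (≤-reflexive (trans N≡ (cong suc (sym (+-suc (3 + k) (6 + k)))))) ⟩
    3 + k                           ∎
    where
      open ≤-Reasoning
      z∷L⊆H-nbhd : ∀ x → x ∈ᵇ (z ∷ L) ≡ true → adj H v₀ x ≡ true
      z∷L⊆H-nbhd x h with x ≟ z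
      ... | yes refl = complement-adj⁺ G (≢-sym (proj₁ (outside⇒ Zz))) (trans (adj-sym G v₀ z) Gzv₀)
      ... | no  _    = inL⇒adj h
      v₀-H-degree : 7 + k ≤ deg H v₀
      v₀-H-degree = begin
        7 + k               ≡⟨ cong suc length-L ⟨
        length (z ∷ L)      ≡⟨ count-∈ᵇ (∈ᵇ≡false⇒∉ L (proj₂ (outside⇒ Zz)) ∷ unique-L) ⟨
        count (_∈ᵇ (z ∷ L)) ≤⟨ count-mono z∷L⊆H-nbhd ⟩
        deg H v₀            ∎

  H-degree-into-L : ∀ {z} → outside z ≡ true → 3 ≤ count (L-neighbour z)
  H-degree-into-L {z} Zz = +-cancelˡ-≤ (3 + k) _ _ (begin
    3 + k + 3                       ≡⟨ +-comm (3 + k) 3 ⟩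
    6 + k                           ≡⟨ count-inL ⟨
    count inL                       ≡⟨ count-split inL (adj G z) ⟩
    count (λ x → inL x ∧ adj G z x) + count (λ x → inL x ∧ not (adj G z x))
                                    ≤⟨ +-mono-≤ (G-degree-into-L Zz) (count-mono non-G⇒H) ⟩
    3 + k + count (L-neighbour z)   ∎)
    where
      open ≤-Reasoning
      non-G⇒H : ∀ x → inL x ∧ not (adj G z x) ≡ true → L-neighbour z x ≡ true
      non-G⇒H x h = let Lx , ¬Gzx = ∧-true⁻ {inL x} h in
        ∧-true⁺ Lx (complement-adj⁺ G (separated inL Lx (proj₂ (outside⇒ Zz)) ∘ sym)
                                      (trans (sym (not-involutive _)) (cong not ¬Gzx)))

  popular-leaf : ∀ hi → hi * (6 + k) < 3 * (4 + k) → ∃[ x ] inL x ≡ true × hi < count (Z-neighbour x)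
  popular-leaf hi ratio = double-counting-∃ outside inL (adj H) (begin-strict
    hi * count inL    ≡⟨ cong (hi *_) count-inL ⟩
    hi * (6 + k)      <⟨ ratio ⟩
    3 * (4 + k)       ≤⟨ *-monoʳ-≤ 3 count-outside ⟩
    3 * count outside ∎) (λ _ → H-degree-into-L)
    where open ≤-Reasoning

  StarWithPendants-in-H :
    ∀ {attach} (Bs Ps : List (Fin N)) → length Bs ≡ 6 + k → length Ps ≡ 3 → Unique Bs → Unique Ps →
    All (λ x → inL x ≡ true) Bs → All (λ z → outside z ≡ true) Ps →
    (∀ {t} → t < 3 → attach t < 6 + k → adj H (nth v₀ Bs (attach t)) (nth v₀ Ps t) ≡ true) →
    Contains H (10 + k) (StarWithPendants (6 + k) 3 attach)
  StarWithPendants-in-H Bs Ps ∣Bs∣ ∣Ps∣ uBs uPs Bs⊆L Ps⊆Z =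
    StarWithPendants-Contains H v₀ Bs Ps ∣Bs∣ ∣Ps∣
      (++⁺ (All.map (adj⇒≢ H ∘ inL⇒adj) Bs⊆L) (All.map (≢-sym ∘ proj₁ ∘ outside⇒) Ps⊆Z)
        ∷ AllPairs.++⁺ uBs uPs (All.map (λ Lx → All.map (separated inL Lx ∘ proj₂ ∘ outside⇒) Ps⊆Z) Bs⊆L))
      (All.map inL⇒adj Bs⊆L)

  T‴-in-H : Contains H (10 + k) (T‴ (10 + k))
  T‴-in-H
    with a , Za , a∉ ← pick outside [] (≤-trans (s≤s z≤n) count-outside)
    with b , Zb , b∉ ← pick outside (a ∷ []) (≤-trans (s≤s (s≤s z≤n)) count-outside)
    with c , Zc , c∉ ← pick outside (a ∷ b ∷ []) (≤-trans (s≤s (s≤s (s≤s z≤n))) count-outside)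
    with x₁ , Lx₁ , x₁∉ ← pick (L-neighbour a) [] (≤-trans (s≤s z≤n) (H-degree-into-L Za))
    with x₂ , Lx₂ , x₂∉ ← pick (L-neighbour b) (x₁ ∷ []) (≤-trans (s≤s (s≤s z≤n)) (H-degree-into-L Zb))
    with x₃ , Lx₃ , x₃∉ ← pick (L-neighbour c) (x₁ ∷ x₂ ∷ []) (H-degree-into-L Zc)
    with rest ← select inL (x₁ ∷ x₂ ∷ x₃ ∷ []) (3 + k) (≤-reflexive (trans (+-comm (3 + k) 3) (sym count-inL)))
    = Contains-⇒ H {E = T‴ (10 + k)} (T‴⇒StarWithPendants k)
        (StarWithPendants-in-H ((x₁ ∷ x₂ ∷ x₃ ∷ []) ++ elems rest) (a ∷ b ∷ c ∷ [])
          (cong (3 +_) (length≡ rest)) refl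
          (unique-++ (unique-∷ʳ (unique-∷ʳ ([] ∷ []) x₂∉) x₃∉) (unique rest) (avoids rest))
          (unique-∷ʳ (unique-∷ʳ ([] ∷ []) b∉) c∉)
          ( proj₁ (L-neighbour⁻ a x₁ Lx₁) ∷ proj₁ (L-neighbour⁻ b x₂ Lx₂) ∷ proj₁ (L-neighbour⁻ c x₃ Lx₃)
          ∷ satisfy rest)
          (Za ∷ Zb ∷ Zc ∷ [])
          λ { {0} _ _ → proj₂ (L-neighbour⁻ a x₁ Lx₁)
            ; {1} _ _ → proj₂ (L-neighbour⁻ b x₂ Lx₂)
            ; {2} _ _ → proj₂ (L-neighbour⁻ c x₃ Lx₃)
            ; {suc (suc (suc _))} (s≤s (s≤s (s≤s ()))) _ })
    where open Selection

  T″-in-H : Contains H (10 + k) (T″ (10 + k))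
  T″-in-H
    with x , Lx , many ← popular-leaf 1 (1*[6+k]<3*[4+k] k)
    with a , Za , a∉ ← pick (Z-neighbour x) [] (≤-trans (s≤s z≤n) many)
    with b , Zb , b∉ ← pick (Z-neighbour x) (a ∷ []) many
    with c , Zc , c∉ ← pick outside (a ∷ b ∷ []) (≤-trans (s≤s (s≤s (s≤s z≤n))) count-outside)
    with y , Ly , y∉ ← pick (L-neighbour c) (x ∷ []) (≤-trans (s≤s (s≤s z≤n)) (H-degree-into-L Zc))
    with rest ← select inL (x ∷ y ∷ []) (4 + k) (≤-reflexive (trans (+-comm (4 + k) 2) (sym count-inL)))
    = Contains-⇒ H {E = T″ (10 + k)} (T″⇒StarWithPendants k)
        (StarWithPendants-in-H ((x ∷ y ∷ []) ++ elems rest) (a ∷ b ∷ c ∷ [])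
          (cong (2 +_) (length≡ rest)) refl
          (unique-++ (unique-∷ʳ ([] ∷ []) y∉) (unique rest) (avoids rest))
          (unique-∷ʳ (unique-∷ʳ ([] ∷ []) b∉) c∉)
          (Lx ∷ proj₁ (L-neighbour⁻ c y Ly) ∷ satisfy rest)
          (proj₁ (Z-neighbour⁻ x a Za) ∷ proj₁ (Z-neighbour⁻ x b Zb) ∷ Zc ∷ [])
          λ { {0} _ _ → proj₂ (Z-neighbour⁻ x a Za)
            ; {1} _ _ → proj₂ (Z-neighbour⁻ x b Zb)
            ; {2} _ _ → proj₂ (L-neighbour⁻ c y Ly)
            ; {suc (suc (suc _))} (s≤s (s≤s (s≤s ()))) _ })
    where open Selection

  T³-in-H : 1 ≤ k → Contains H (10 + k) (T³ (10 + k))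
  T³-in-H 1≤k
    with x , Lx , many ← popular-leaf 2 (2*[6+k]<3*[4+k] 1≤k)
    with a , Za , a∉ ← pick (Z-neighbour x) [] (≤-trans (s≤s z≤n) many)
    with b , Zb , b∉ ← pick (Z-neighbour x) (a ∷ []) (≤-trans (s≤s (s≤s z≤n)) many)
    with c , Zc , c∉ ← pick (Z-neighbour x) (a ∷ b ∷ []) many
    with rest ← select inL (x ∷ []) (5 + k) (≤-reflexive (trans (+-comm (5 + k) 1) (sym count-inL)))
    = let last-adj : ∀ z → Z-neighbour x z ≡ true → adj H (nth v₀ (elems rest ++ x ∷ []) (5 + k)) z ≡ true
          last-adj z Zz = subst (λ y → adj H y z ≡ true) (sym (nth-∷ʳ v₀ (elems rest) (length≡ rest)))
                                (proj₂ (Z-neighbour⁻ x z Zz))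
      in Contains-⇒ H {E = T³ (10 + k)} (T³⇒StarWithPendants k)
        (StarWithPendants-in-H (elems rest ++ x ∷ []) (a ∷ b ∷ c ∷ [])
          (trans (length-++ (elems rest)) (trans (cong (_+ 1) (length≡ rest)) (+-comm (5 + k) 1))) refl
          (unique-∷ʳ (unique rest) (All.map (λ { (r≢x ∷ []) → ≢-sym r≢x }) (avoids rest)))
          (unique-∷ʳ (unique-∷ʳ ([] ∷ []) b∉) c∉)
          (++⁺ (satisfy rest) (Lx ∷ []))
          (proj₁ (Z-neighbour⁻ x a Za) ∷ proj₁ (Z-neighbour⁻ x b Zb) ∷ proj₁ (Z-neighbour⁻ x c Zc) ∷ [])
          λ { {0} _ _ → last-adj a Za
            ; {1} _ _ → last-adj b Zb
            ; {2} _ _ → last-adj c Zc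
            ; {suc (suc (suc _))} (s≤s (s≤s (s≤s ()))) _ })
    where open Selection

-- The lower-bound graph

-- Vertices below s form one clique and the others a second one; when N ≤ 2s both have at most s
-- vertices, and the complement is the complete bipartite graph between them.
module TwoCliques (s N : ℕ) (N≤ : N ≤ s + s) where

  side : Fin N → Bool
  side v = toℕ v <ᵇ s

  G : SimpleGraph N
  G = record
    { adj        = λ v w → not (does (v ≟ w)) ∧ not (side v xor side w)
    ; adj-sym    = λ v w → cong₂ (λ e x → not e ∧ not x) (does-≟-sym v w) (xor-comm (side v) (side w))
    ; adj-irrefl = λ v → cong (λ e → not e ∧ not (side v xor side v)) (dec-true (v ≟ v) refl)
    }
    where
      does-≟-sym : ∀ v w → does (v ≟ w) ≡ does (w ≟ v)
      does-≟-sym v w with v ≟ w | w ≟ v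
      ... | yes _   | yes _   = refl
      ... | no  _   | no  _   = refl
      ... | yes v≡w | no  w≢v = ⊥-elim (w≢v (sym v≡w))
      ... | no  v≢w | yes w≡v = ⊥-elim (v≢w (sym w≡v))

  side-adj : ∀ {v w} → adj G v w ≡ true → side w ≡ side v
  side-adj {v} {w} Gvw = same (side v) (side w) (proj₂ (∧-true⁻ {not (does (v ≟ w))} Gvw))
    where
      same : ∀ a b → not (a xor b) ≡ true → b ≡ a
      same false false _ = refl
      same true  true  _ = refl

  side-complement-adj : ∀ {v w} → adj (complement G) v w ≡ true → side w ≡ not (side v)
  side-complement-adj {v} {w} Hvw = opposite (side v) (side w)
    (trans (cong (λ e → not e ∧ not (side v xor side w)) (sym (dec-false (v ≟ w) (adj⇒≢ (complement G) Hvw))))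
           (complement-adj⁻ G Hvw))
    where
      opposite : ∀ a b → not (a xor b) ≡ false → b ≡ not a
      opposite false true  _ = refl
      opposite true  false _ = refl

  side≡false⇒s≤ : ∀ {v} → side v ≡ false → s ≤ toℕ v
  side≡false⇒s≤ {v} sv = ≮⇒≥ λ v<s → subst T sv (<⇒<ᵇ v<s)

  offset : Bool → Fin N → ℕ
  offset true  v = toℕ v
  offset false v = toℕ v ∸ s

  offset<s : ∀ b v → side v ≡ b → offset b v < s
  offset<s true  v sv = <ᵇ⇒< (toℕ v) s (subst T (sym sv) tt)
  offset<s false v sv =
    subst (toℕ v ∸ s <_) (m+n∸n≡m s s) (∸-monoˡ-< (≤-trans (toℕ<n v) N≤) (side≡false⇒s≤ sv))

  offset-injective : ∀ b {v w} → side v ≡ b → side w ≡ b → offset b v ≡ offset b w → v ≡ w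
  offset-injective true  _  _  eq = toℕ-injective eq
  offset-injective false sv sw eq = toℕ-injective (∸-cancelʳ-≡ (side≡false⇒s≤ sv) (side≡false⇒s≤ sw) eq)

  one-side-small : (g : Fin (suc s) → Fin N) → Injective _≡_ _≡_ g → ∀ b → (∀ i → side (g i) ≡ b) → ⊥
  one-side-small g g-inj b same
    with i , j , i<j , eq ← pigeonhole (n<1+n s) (λ i → fromℕ< (offset<s b (g i) (same i)))
    = <⇒≢ i<j (cong toℕ (g-inj (offset-injective b (same i) (same j)
        (trans (sym (toℕ-fromℕ< _)) (trans (cong toℕ eq) (toℕ-fromℕ< _))))))

  no-arrow : ∀ {k₁ k₂} → s < k₁ → suc s < k₂ → {E₁ E₂ : ℕ → ℕ → Set} →
             (∀ {a b} → starEdge s a b → E₁ a b) → (∀ {a b} → starEdge (suc s) a b → E₂ a b) →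
             ¬ Arrows N k₁ E₁ k₂ E₂
  no-arrow s<k₁ s<k₂ {E₁} {E₂} star⇒E₁ star⇒E₂ arrows with arrows G
  ... | inj₁ G⊇E₁ =
    let g , g-inj , g-adj = Contains-star G s<k₁ (Contains-⇒ G {E = starEdge s} star⇒E₁ G⊇E₁)
    in one-side-small g g-inj (side (g zero)) λ { zero → refl ; (suc i) → side-adj {g zero} (g-adj i) }
  ... | inj₂ H⊇E₂ =
    let H = complement G
        g , g-inj , g-adj = Contains-star H s<k₂ (Contains-⇒ H {E = starEdge (suc s)} star⇒E₂ H⊇E₂)
    in one-side-small (g ∘ suc) (suc-injective ∘ g-inj) (not (side (g zero)))
         λ i → side-complement-adj {g zero} (g-adj i)

module _ (k : ℕ) {E : ℕ → ℕ → Set} {attach : ℕ → ℕ}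
         (E⇒StarWithPendants : ∀ {a b} → E a b → StarWithPendants (6 + k) 3 attach a b)
         (low-degree : ∀ (G : SimpleGraph (suc ((4 + k) + (6 + k)))) v₀ →
                       (∀ w → deg G w ≤ deg G v₀) → (∀ w → deg G w ≤ 4 + k) → Contains (complement G) (10 + k) E)
         where

  private
    N≥ : 11 + k ≤ suc ((4 + k) + (6 + k))
    N≥ = s≤s (+-monoˡ-≤ (6 + k) (m≤m+n 4 k))

    below : ∀ {d} {G : SimpleGraph (suc ((4 + k) + (6 + k)))} → ¬ (∃[ v ] suc d ≤ deg G v) → ∀ v → deg G v ≤ d
    below ∄ v = ≤-pred (≰⇒> (∄ ∘ (v ,_)))

    Biclique⇒E : ∀ {G : SimpleGraph (suc ((4 + k) + (6 + k)))} → Biclique (complement G) 4 (6 + k) →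
                 Contains (complement G) (10 + k) E
    Biclique⇒E {G} B = Contains-⇒ (complement G) {E = E} E⇒StarWithPendants (Biclique⇒StarWithPendants (complement G) B)

  T′-arrows : Arrows (suc ((4 + k) + (6 + k))) (7 + k) (T′ (7 + k)) (10 + k) E
  T′-arrows G with any? (λ v → 6 + k ≤? deg G v)
  ... | yes (v , dv) = Sum.map₂ (Biclique⇒E {G}) (high-degree G k v dv N≥)
  ... | no  ∄high with any? (λ v → 5 + k ≤? deg G v)
  ...   | yes (v , dv) =
    Sum.map₂ (Biclique⇒E {G}) (critical-degree G k v dv (below {5 + k} {G} ∄high v) (≤-trans (n≤1+n _) N≥))
  ...   | no  ∄critical = inj₂ (low-degree G v₀ v₀-max (below {4 + k} {G} ∄critical))
    where
      v₀ : Fin (suc ((4 + k) + (6 + k)))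
      v₀ = argmax (deg G) zero (allFin _)
      v₀-max : ∀ w → deg G w ≤ deg G v₀
      v₀-max w = All.lookup (f[xs]≤f[argmax] {f = deg G} zero (allFin _)) (∈-allFin w)

  T′-ramsey-number : (∀ {a b} → starEdge (6 + k) a b → E a b) →
                     IsRamseyNumber (7 + k) (T′ (7 + k)) (10 + k) E (2 * (10 + k) ∸ 9)
  T′-ramsey-number star⇒E = subst (IsRamseyNumber (7 + k) (T′ (7 + k)) (10 + k) E) (sym 2*[10+k]∸9)
    ( s≤s z≤n
    , T′-arrows
    , λ N _ N< → TwoCliques.no-arrow (5 + k) N (≤-trans (≤-pred N<) (≤-reflexive (+-suc (4 + k) (5 + k))))
                   (n≤1+n (6 + k)) (m≤n+m (7 + k) 3) {E₁ = T′ (7 + k)} inj₁ star⇒E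
    )
    where
      2*[10+k]∸9 : 2 * (10 + k) ∸ 9 ≡ suc ((4 + k) + (6 + k))
      2*[10+k]∸9 = trans (cong (_∸ 9) (eq k)) (m+n∸m≡n 9 _)
        where
          eq : ∀ k → 2 * (10 + k) ≡ 9 + suc ((4 + k) + (6 + k))
          eq = solve-∀

theorem5p3 : (n : ℕ) →
    (10 ≤ n → IsRamseyNumber (n ∸ 3) (T′ (n ∸ 3)) n (T″ n) (2 * n ∸ 9)
    × IsRamseyNumber (n ∸ 3) (T′ (n ∸ 3)) n (T‴ n) (2 * n ∸ 9))
    × (15 ≤ n → IsRamseyNumber (n ∸ 3) (T′ (n ∸ 3)) n (T³ n) (2 * n ∸ 9))
theorem5p3 n = (λ 10≤n → T″-and-T‴ (m≤n⇒∃[o]m+o≡n 10≤n)) , (λ 15≤n → T³-case (m≤n⇒∃[o]m+o≡n 15≤n))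
  where
    T″-and-T‴ : ∃[ k ] 10 + k ≡ n → IsRamseyNumber (n ∸ 3) (T′ (n ∸ 3)) n (T″ n) (2 * n ∸ 9)
                                  × IsRamseyNumber (n ∸ 3) (T′ (n ∸ 3)) n (T‴ n) (2 * n ∸ 9)
    T″-and-T‴ (k , refl) =
        T′-ramsey-number k (T″⇒StarWithPendants k) (λ G → LowMaxDegree.T″-in-H G k refl) inj₁
      , T′-ramsey-number k (T‴⇒StarWithPendants k) (λ G → LowMaxDegree.T‴-in-H G k refl) inj₁

    -- The argument only needs n ≥ 11 here.
    T³-case : ∃[ j ] 15 + j ≡ n → IsRamseyNumber (n ∸ 3) (T′ (n ∸ 3)) n (T³ n) (2 * n ∸ 9)
    T³-case (j , refl) =
      T′-ramsey-number (5 + j) (T³⇒StarWithPendants (5 + j))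
        (λ G v₀ v₀-max Δ≤ → LowMaxDegree.T³-in-H G (5 + j) refl v₀ v₀-max Δ≤ (s≤s z≤n)) inj₁
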